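{- Let $(G,k)$ be an instance of CTVD and let $S$ be a (clique, tree)-deletion set of $G$ with $|S| \le 4k$. Let $V_1$ be the union of the vertex sets of the connected components of $G-S$ that are cliques with at least $3$ vertices, and $V_2 = V(G) \setminus (S \cup V_1)$. Let $v$ be a leaf of a connected component $C$ of $G[V_2]$, let $u$ be its neighbor in $C$, and suppose that neither $v$ nor $u$ is adjacent to any vertex of $S$. Then $(G,k)$ is a yes-instance if and only if $(G - v, k)$ is a yes-instance.
   Context: CTVD: given a multigraph $G$ (loops and parallel edges allowed) and an integer $k$, decide whether there is $S\subseteq V(G)$ with $|S|\le k$ such that $G-S$ is simple and every connected component of $G-S$ is a clique or a tree. A (clique, tree)-deletion set of $G$ is any $X \subseteq V(G)$ such that $G - X$ is simple and each of its connected components is a clique or a tree. A leaf of a tree is a vertex of degree one in it. (Every component of $G[V_2]$ is a tree.) -}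

module Defs where

open import Data.Nat using (ℕ; zero; suc; _≤_; _*_)
open import Data.Fin using (Fin; punchIn)
open import Data.Fin.Subset using (Subset; _∈_; _∉_; ∣_∣)
open import Data.List using (List; []; _∷_; _++_; length)
open import Data.List.Relation.Unary.All using (All)
open import Data.List.Relation.Unary.Unique.Propositional using (Unique)
open import Data.Product using (Σ; ∃; _×_; _,_)
open import Data.Sum using (_⊎_)
open import Data.Unit using (⊤)
open import Relation.Nullary using (¬_)
open import Relation.Binary.PropositionalEquality using (_≡_; _≢_)

-- A finite multigraph on vertex set Fin n: mult x y is the number of edges
-- between x and y (mult x x = number of loops at x). Symmetric.
record Multigraph (n : ℕ) : Set where
  field
    mult : Fin n → Fin n → ℕ
    mult-sym : ∀ x y → mult x y ≡ mult y x
open Multigraph public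

VSet : ℕ → Set₁
VSet n = Fin n → Set

_-v_ : ∀ {n} → Multigraph (suc n) → Fin (suc n) → Multigraph n
mult (G -v v) x y = mult G (punchIn v x) (punchIn v y)
mult-sym (G -v v) x y = mult-sym G (punchIn v x) (punchIn v y)

module _ {n : ℕ} (G : Multigraph n) where

  Adj : VSet n → Fin n → Fin n → Set
  Adj U x y = U x × U y × x ≢ y × 1 ≤ mult G x y

  data Reach (U : VSet n) (x : Fin n) : Fin n → Set where
    here : U x → Reach U x x
    step : ∀ {y z} → Reach U x y → Adj U y z → Reach U x z

  Comp : VSet n → Fin n → VSet n
  Comp U x y = Reach U x y

  PathAdj : VSet n → List (Fin n) → Set
  PathAdj U [] = ⊤
  PathAdj U (x ∷ []) = ⊤
  PathAdj U (x ∷ y ∷ r) = Adj U x y × PathAdj U (y ∷ r)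

  record Cycle (U : VSet n) (C : VSet n) : Set where
    field
      start : Fin n
      rest  : List (Fin n)
      long  : 2 ≤ length rest
      distinct : Unique (start ∷ rest)
      inside : All C (start ∷ rest)
      closed : PathAdj U ((start ∷ rest) ++ (start ∷ []))

  IsClique : VSet n → VSet n → Set
  IsClique U C = ∀ x y → C x → C y → x ≢ y → Adj U x y

  -- C is a component (hence connected); tree = acyclic
  IsTree : VSet n → VSet n → Set
  IsTree U C = ¬ Cycle U C

  AtLeast3 : VSet n → Set
  AtLeast3 C = ∃ λ a → ∃ λ b → ∃ λ c →
    C a × C b × C c × a ≢ b × a ≢ c × b ≢ c

  Rest : Subset n → VSet n
  Rest S x = x ∉ S

  SimpleOn : VSet n → Set
  SimpleOn U = (∀ x → U x → mult G x x ≡ 0) × (∀ x y → U x → U y → mult G x y ≤ 1)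

  IsCTDS : Subset n → Set
  IsCTDS S = SimpleOn (Rest S) ×
    (∀ x → Rest S x → IsClique (Rest S) (Comp (Rest S) x) ⊎ IsTree (Rest S) (Comp (Rest S) x))

  V₁ : Subset n → VSet n
  V₁ S x = ∃ λ y → Rest S y × Comp (Rest S) y x ×
    IsClique (Rest S) (Comp (Rest S) y) × AtLeast3 (Comp (Rest S) y)

  V₂ : Subset n → VSet n
  V₂ S x = x ∉ S × ¬ V₁ S x

YesInstance : ∀ {n} → Multigraph n → ℕ → Set
YesInstance {n} G k = ∃ λ (S : Subset n) → ∣ S ∣ ≤ k × IsCTDS G S

{-# OPTIONS --safe #-}

-- Since neither v nor u has a neighbour in S, u is the only neighbour of v in G, and u lies on
-- no triangle of G: such a triangle would lie in the component of G - S containing v, making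
-- that component a clique on at least three vertices and putting v into V₁.
-- A solution X for G gives the solution X - v for G - v, because cliques and acyclic graphs
-- are closed under taking induced subgraphs. Conversely, a solution of G - v stays a solution
-- of G when v is kept outside it: v is a leaf hanging off u, hence on no cycle, and contracting
-- the edge vu maps the component of v onto that of u, which is acyclic (a clique through u has
-- at most two vertices, as u lies on no triangle). All other components are unchanged.

module Submission where

open import Defs
open import Data.Nat using (ℕ; suc; _≤_; _*_; z≤n; s≤s; _≤?_)
open import Data.Nat.Properties using (≤-trans)
open import Data.Fin using (Fin; zero; suc; punchIn; punchOut)
open import Data.Fin.Properties
  using (_≟_; punchIn-injective; punchInᵢ≢i; punchIn-punchOut; punchOut-punchIn)
open import Data.Fin.Subset using (Subset; _∈_; _∉_; ∣_∣; inside; outside)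
open import Data.Fin.Subset.Properties using (_∈?_; ∣p∣≤∣x∷p∣)
open import Data.Vec using ([]; _∷_; lookup; insertAt; removeAt)
open import Data.Vec.Properties using (insertAt-punchIn; removeAt-punchOut; []=⇒lookup; lookup⇒[]=)
open import Data.List using (List; []; _∷_; _++_; _∷ʳ_; [_]; length; map; initLast; _∷ʳ′_)
open import Data.List.Properties using (++-assoc; map-++; length-map; ∷-injectiveˡ; ∷-injectiveʳ)
open import Data.List.Membership.Propositional using () renaming (_∈_ to _∈ᴸ_)
open import Data.List.Membership.Propositional.Properties using (∈-∃++; ∈-++⁺ʳ)
open import Data.List.Relation.Unary.All as All using (All; []; _∷_)
open import Data.List.Relation.Unary.All.Properties using (¬Any⇒All¬; ∷ʳ⁺)
  renaming (map⁺ to All-map⁺; map⁻ to All-map⁻)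
open import Data.List.Relation.Unary.Any using (here)
open import Data.List.Relation.Unary.Unique.Propositional using (Unique)
open import Data.List.Relation.Unary.AllPairs using ([]; _∷_)
import Data.List.Relation.Unary.Unique.Propositional.Properties as Unique
open import Data.Product using (Σ; ∃; ∃₂; _×_; _,_; proj₁; proj₂)
open import Data.Sum using (_⊎_; inj₁; inj₂)
open import Data.Unit using (tt)
open import Data.Empty using (⊥-elim)
open import Function using (_∘_; id)
open import Function.Bundles using (_⇔_; mk⇔; Equivalence)
open import Relation.Nullary using (¬_; Dec; yes; no; contradiction)
open import Relation.Nullary.Decidable using (_×-dec_; ¬?; map′)
open import Relation.Unary using (_⊆_; Decidable)
open import Relation.Binary.PropositionalEquality
  using (_≡_; _≢_; refl; sym; trans; cong; cong₂; subst; subst₂; module ≡-Reasoning)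

private variable
  m n : ℕ
  U W C : VSet n
  x y z a b : Fin n

Edge : Multigraph n → Fin n → Fin n → Set
Edge G x y = x ≢ y × 1 ≤ mult G x y

OnTriangle : Multigraph n → Fin n → Set
OnTriangle G x = ∃₂ λ a b → Edge G x a × Edge G x b × Edge G a b

SimpleAt : Multigraph n → Fin n → Set
SimpleAt G v = mult G v v ≡ 0 × (∀ y → mult G v y ≤ 1)

-- IsCTDS G S unfolds to CliqueTreeOn G (Rest G S).
CliqueTreeOn : Multigraph n → VSet n → Set
CliqueTreeOn G U = SimpleOn G U × (∀ x → U x → IsClique G U (Comp G U x) ⊎ IsTree G U (Comp G U x))

_∖_ : VSet n → Fin n → VSet n
(U ∖ v) z = U z × v ≢ z

Unique-rotate : ∀ {A : Set} {x : A} {xs} → Unique (x ∷ xs) → Unique (xs ∷ʳ x)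
Unique-rotate (x∉xs ∷ xs!) =
  Unique.++⁺ xs! ([] ∷ []) λ { (x∈xs , here refl) → All.lookup x∉xs x∈xs refl }

Reach-map : {G : Multigraph m} {H : Multigraph n} {U : VSet m} {W : VSet n} (f : Fin m → Fin n)
  → (∀ {x} → U x → W (f x)) → (∀ {x y} → Adj G U x y → Adj H W (f x) (f y))
  → ∀ {x y} → Reach G U x y → Reach H W (f x) (f y)
Reach-map f Uf adjf (here Ux) = here (Uf Ux)
Reach-map f Uf adjf (step r xy) = step (Reach-map f Uf adjf r) (adjf xy)

PathAdj-map : {G : Multigraph m} {H : Multigraph n} {U : VSet m} {W : VSet n} (f : Fin m → Fin n)
  → (∀ {x y} → Adj G U x y → Adj H W (f x) (f y))
  → ∀ xs → PathAdj G U xs → PathAdj H W (map f xs)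
PathAdj-map f adjf [] _ = tt
PathAdj-map f adjf (x ∷ []) _ = tt
PathAdj-map f adjf (x ∷ y ∷ xs) (xy , p) = adjf xy , PathAdj-map f adjf (y ∷ xs) p

PathAdj-map⁻ : {G : Multigraph m} {H : Multigraph n} {U : VSet m} {W : VSet n} (f : Fin m → Fin n)
  → (∀ {x y} → Adj H W (f x) (f y) → Adj G U x y)
  → ∀ xs → PathAdj H W (map f xs) → PathAdj G U xs
PathAdj-map⁻ f adjf [] _ = tt
PathAdj-map⁻ f adjf (x ∷ []) _ = tt
PathAdj-map⁻ f adjf (x ∷ y ∷ xs) (xy , p) = adjf xy , PathAdj-map⁻ f adjf (y ∷ xs) p

open Cycle using (start; rest)

vertices : {G : Multigraph n} → Cycle G U C → List (Fin n)
vertices c = start c ∷ rest c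

Cycle-map : {G : Multigraph m} {H : Multigraph n} {U C : VSet m} {W D : VSet n} (f : Fin m → Fin n)
  → (∀ {x y} → f x ≡ f y → x ≡ y)
  → (∀ {x y} → Adj G U x y → Adj H W (f x) (f y))
  → (∀ {x} → C x → D (f x))
  → Cycle G U C → Cycle H W D
Cycle-map {H = H} {W = W} f f-injective adjf Cf c = record
  { start = f (start c)
  ; rest = map f (rest c)
  ; long = subst (2 ≤_) (sym (length-map f (rest c))) (Cycle.long c)
  ; distinct = Unique.map⁺ f-injective (Cycle.distinct c)
  ; inside = All-map⁺ (All.map Cf (Cycle.inside c))
  ; closed = subst (PathAdj H W) (map-++ f (vertices c) [ start c ]) (PathAdj-map f adjf _ (Cycle.closed c))
  }

module _ {n : ℕ} (G : Multigraph n) where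

  Edge-sym : Edge G x y → Edge G y x
  Edge-sym {x = x} {y = y} (x≢y , xy) = x≢y ∘ sym , subst (1 ≤_) (mult-sym G x y) xy

  Adj-sym : Adj G U x y → Adj G U y x
  Adj-sym (Ux , Uy , xy) = Uy , Ux , Edge-sym xy

  Adj-mono : W ⊆ U → Adj G W x y → Adj G U x y
  Adj-mono W⊆U (Wx , Wy , xy) = W⊆U Wx , W⊆U Wy , xy

  Reach-start : Reach G U x y → U x
  Reach-start (here Ux) = Ux
  Reach-start (step r _) = Reach-start r

  Reach-end : Reach G U x y → U y
  Reach-end (here Uy) = Uy
  Reach-end (step _ (_ , Uy , _)) = Uy

  Reach-mono : W ⊆ U → Reach G W x y → Reach G U x y
  Reach-mono W⊆U = Reach-map id W⊆U (Adj-mono W⊆U)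

  PathAdj-restrict : {P : VSet n} → ∀ xs → All P xs → PathAdj G U xs → PathAdj G (λ z → U z × P z) xs
  PathAdj-restrict [] _ _ = tt
  PathAdj-restrict (x ∷ []) _ _ = tt
  PathAdj-restrict (x ∷ y ∷ xs) (Px ∷ Py ∷ Ps) ((Ux , Uy , xy) , p) =
    ((Ux , Px) , (Uy , Py) , xy) , PathAdj-restrict (y ∷ xs) (Py ∷ Ps) p

  PathAdj-∷ʳ⁺ : ∀ xs → PathAdj G U (xs ∷ʳ y) → Adj G U y z → PathAdj G U (xs ∷ʳ y ∷ʳ z)
  PathAdj-∷ʳ⁺ [] _ yz = yz , tt
  PathAdj-∷ʳ⁺ (x ∷ []) (xy , _) yz = xy , yz , tt
  PathAdj-∷ʳ⁺ (x ∷ x₁ ∷ xs) (xx₁ , p) yz = xx₁ , PathAdj-∷ʳ⁺ (x₁ ∷ xs) p yz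

  PathAdj-∷ʳ⁻ : ∀ xs → PathAdj G U (xs ∷ʳ y ∷ʳ z) → Adj G U y z
  PathAdj-∷ʳ⁻ [] (yz , _) = yz
  PathAdj-∷ʳ⁻ (x ∷ []) (_ , yz , _) = yz
  PathAdj-∷ʳ⁻ (x ∷ x₁ ∷ xs) (_ , p) = PathAdj-∷ʳ⁻ (x₁ ∷ xs) p

  Cycle-restrict : {P D : VSet n} (c : Cycle G U C) → All P (vertices c) → All D (vertices c)
    → Cycle G (λ z → U z × P z) D
  Cycle-restrict c Ps Ds = record
    { start = start c
    ; rest = rest c
    ; long = Cycle.long c
    ; distinct = Cycle.distinct c
    ; inside = Ds
    ; closed = PathAdj-restrict (vertices c ∷ʳ start c) (∷ʳ⁺ Ps (All.head Ps)) (Cycle.closed c)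
    }

  rotate : Cycle G U C → Cycle G U C
  rotate record { rest = [] ; long = () }
  rotate record { rest = _ ∷ [] ; long = s≤s () }
  rotate c@record { start = s ; rest = a ∷ b ∷ r } = record
    { start = a
    ; rest = b ∷ r ∷ʳ s
    ; long = s≤s (1≤length-∷ʳ r)
    ; distinct = Unique-rotate (Cycle.distinct c)
    ; inside = ∷ʳ⁺ (All.tail (Cycle.inside c)) (All.head (Cycle.inside c))
    ; closed = PathAdj-∷ʳ⁺ (a ∷ b ∷ r) (proj₂ (Cycle.closed c)) (proj₁ (Cycle.closed c))
    }
    where
    1≤length-∷ʳ : ∀ xs → 1 ≤ length (xs ∷ʳ s)
    1≤length-∷ʳ [] = s≤s z≤n
    1≤length-∷ʳ (_ ∷ _) = s≤s z≤n

  vertices-rotate : (c : Cycle G U C) → vertices (rotate c) ≡ rest c ∷ʳ start c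
  vertices-rotate record { rest = [] ; long = () }
  vertices-rotate record { rest = _ ∷ [] ; long = s≤s () }
  vertices-rotate record { rest = _ ∷ _ ∷ _ } = refl

  rotate-to : ∀ ys {zs} (c : Cycle G U C) → vertices c ≡ ys ++ x ∷ zs
    → Σ (Cycle G U C) λ c′ → start c′ ≡ x
  rotate-to [] c eq = c , ∷-injectiveˡ eq
  rotate-to {x = x} (y ∷ ys) {zs} c eq = rotate-to ys (rotate c) (begin
    vertices (rotate c)  ≡⟨ vertices-rotate c ⟩
    rest c ∷ʳ start c    ≡⟨ cong₂ _∷ʳ_ (∷-injectiveʳ eq) (∷-injectiveˡ eq) ⟩
    (ys ++ x ∷ zs) ∷ʳ y  ≡⟨ ++-assoc ys (x ∷ zs) [ y ] ⟩
    ys ++ x ∷ zs ∷ʳ y    ∎)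
    where open ≡-Reasoning

  start-has-two-neighbours : (c : Cycle G U C)
    → ∃₂ λ y z → y ≢ z × Adj G U (start c) y × Adj G U (start c) z
  start-has-two-neighbours record { rest = [] ; long = () }
  start-has-two-neighbours record
    { rest = a ∷ r ; long = s≤s 1≤∣r∣ ; distinct = _ ∷ (a∉r ∷ _) ; closed = sa , p } with initLast r
  ... | [] = contradiction 1≤∣r∣ λ ()
  ... | ini ∷ʳ′ l =
    a , l , All.lookup a∉r (∈-++⁺ʳ ini (here refl)) , sa , Adj-sym (PathAdj-∷ʳ⁻ (a ∷ ini) p)

  cycle-vertex-has-two-neighbours : (c : Cycle G U C) → x ∈ᴸ vertices c
    → ∃₂ λ y z → y ≢ z × Adj G U x y × Adj G U x z
  cycle-vertex-has-two-neighbours c x∈c with ∈-∃++ x∈c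
  ... | ys , _ , eq with rotate-to ys c eq
  ...   | c′ , refl = start-has-two-neighbours c′

  leaf-∉-Cycle : (∀ {y z} → Adj G U x y → Adj G U x z → y ≡ z)
    → (c : Cycle G U C) → ¬ x ∈ᴸ vertices c
  leaf-∉-Cycle one-neighbour c x∈c with cycle-vertex-has-two-neighbours c x∈c
  ... | y , z , y≢z , xy , xz = y≢z (one-neighbour xy xz)

  Cycle⇒AtLeast3 : Cycle G U C → AtLeast3 G C
  Cycle⇒AtLeast3 record { rest = [] ; long = () }
  Cycle⇒AtLeast3 record { rest = _ ∷ [] ; long = s≤s () }
  Cycle⇒AtLeast3 record
    { start = s ; rest = a ∷ b ∷ _
    ; distinct = (s≢a ∷ s≢b ∷ _) ∷ (a≢b ∷ _) ∷ _
    ; inside = Cs ∷ Ca ∷ Cb ∷ _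
    } = s , a , b , Cs , Ca , Cb , s≢a , s≢b , a≢b

  IsClique-triangle : IsClique G U C → C x → C y → C z → x ≢ y → x ≢ z → y ≢ z → OnTriangle G x
  IsClique-triangle {x = x} {y = y} {z = z} clique Cx Cy Cz x≢y x≢z y≢z =
    y , z , proj₂ (proj₂ (clique x y Cx Cy x≢y)) , proj₂ (proj₂ (clique x z Cx Cz x≢z))
          , proj₂ (proj₂ (clique y z Cy Cz y≢z))

  IsClique⇒OnTriangle : IsClique G U C → C x → AtLeast3 G C → OnTriangle G x
  IsClique⇒OnTriangle {x = x} clique Cx (a , b , c , Ca , Cb , Cc , a≢b , a≢c , b≢c) with x ≟ a | x ≟ b
  ... | yes refl | _ = IsClique-triangle clique Cx Cb Cc a≢b a≢c b≢c
  ... | no x≢a | yes refl = IsClique-triangle clique Cx Ca Cc x≢a b≢c a≢c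
  ... | no x≢a | no x≢b = IsClique-triangle clique Cx Ca Cb x≢a x≢b a≢b

  IsClique⇒IsTree : IsClique G U C → C x → ¬ OnTriangle G x → IsTree G U C
  IsClique⇒IsTree clique Cx x-free = x-free ∘ IsClique⇒OnTriangle clique Cx ∘ Cycle⇒AtLeast3

  Triangle⇒IsClique : IsClique G U C ⊎ IsTree G U C → C x → C a → C b
    → Adj G U x a → Adj G U a b → Adj G U b x → IsClique G U C
  Triangle⇒IsClique (inj₁ clique) _ _ _ _ _ _ = clique
  Triangle⇒IsClique (inj₂ tree) Cx Ca Cb
    xa@(_ , _ , x≢a , _) ab@(_ , _ , a≢b , _) bx@(_ , _ , b≢x , _) =
    ⊥-elim (tree record
      { start = _ ; rest = _ ∷ _ ∷ [] ; long = s≤s (s≤s z≤n)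
      ; distinct = (x≢a ∷ b≢x ∘ sym ∷ []) ∷ (a≢b ∷ []) ∷ [] ∷ []
      ; inside = Cx ∷ Ca ∷ Cb ∷ []
      ; closed = xa , ab , bx , tt
      })

  Adj? : Decidable U → ∀ x y → Dec (Adj G U x y)
  Adj? U? x y = U? x ×-dec U? y ×-dec ¬? (x ≟ y) ×-dec (1 ≤? mult G x y)

  Comp-clique? : Decidable U → IsClique G U (Comp G U x) → U x → Decidable (Comp G U x)
  Comp-clique? {x = x} U? clique Ux y with x ≟ y
  ... | yes refl = yes (here Ux)
  ... | no x≢y = map′ (step (here Ux)) (λ x→y → clique x y (here Ux) x→y x≢y) (Adj? U? x y)

  SimpleOn-mono : W ⊆ U → SimpleOn G U → SimpleOn G W
  SimpleOn-mono W⊆U (loopless , ≤1) =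
    (λ x Wx → loopless x (W⊆U Wx)) , λ x y Wx Wy → ≤1 x y (W⊆U Wx) (W⊆U Wy)

  CliqueTreeOn-mono : W ⊆ U → CliqueTreeOn G U → CliqueTreeOn G W
  CliqueTreeOn-mono {W = W} {U = U} W⊆U (simple , comps) = SimpleOn-mono W⊆U simple , components
    where
    components : ∀ x → W x → IsClique G W (Comp G W x) ⊎ IsTree G W (Comp G W x)
    components x Wx with comps x (W⊆U Wx)
    ... | inj₁ clique = inj₁ λ a b x→a x→b a≢b →
          let (_ , _ , ab) = clique a b (Reach-mono W⊆U x→a) (Reach-mono W⊆U x→b) a≢b
          in Reach-end x→a , Reach-end x→b , ab
    ... | inj₂ tree = inj₂ (tree ∘ Cycle-map id id (Adj-mono W⊆U) (Reach-mono W⊆U))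

module VertexDeletion {m : ℕ} (G : Multigraph (suc m)) (v : Fin (suc m)) {U : VSet (suc m)} {U′ : VSet m}
  (U′⇔U : ∀ {z} → U′ z ⇔ U (punchIn v z)) (v∉U : ¬ U v) where

  private
    G′ = G -v v
    ι = punchIn v
    to : U′ z → U (ι z)
    to = Equivalence.to U′⇔U
    from : U (ι z) → U′ z
    from = Equivalence.from U′⇔U

  ι-injective : ι x ≡ ι y → x ≡ y
  ι-injective = punchIn-injective v _ _

  preimage : U z → ∃ λ z′ → ι z′ ≡ z
  preimage Uz = punchOut v≢z , punchIn-punchOut v≢z
    where
    v≢z : v ≢ _
    v≢z refl = v∉U Uz

  preimages : ∀ {zs} → All U zs → ∃ λ ys → map ι ys ≡ zs
  preimages [] = [] , refl
  preimages (Uz ∷ Uzs) with preimage Uz | preimages Uzs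
  ... | y , refl | ys , refl = y ∷ ys , refl

  Adj-ι⁺ : Adj G′ U′ x y → Adj G U (ι x) (ι y)
  Adj-ι⁺ (Ux , Uy , x≢y , xy) = to Ux , to Uy , x≢y ∘ ι-injective , xy

  Adj-ι⁻ : Adj G U (ι x) (ι y) → Adj G′ U′ x y
  Adj-ι⁻ (Ux , Uy , x≢y , xy) = from Ux , from Uy , x≢y ∘ cong ι , xy

  Reach-ι⁺ : Reach G′ U′ x y → Reach G U (ι x) (ι y)
  Reach-ι⁺ = Reach-map ι to Adj-ι⁺

  Reach-ι⁻ : Reach G U (ι x) z → ∃ λ z′ → ι z′ ≡ z × Reach G′ U′ x z′
  Reach-ι⁻ {x = x} (here Ux) = x , refl , here (from Ux)
  Reach-ι⁻ (step r yz@(_ , Uz , _)) with Reach-ι⁻ r | preimage Uz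
  ... | _ , refl , r′ | z′ , refl = z′ , refl , step r′ (Adj-ι⁻ yz)

  Comp-ι⁻ : Comp G U (ι x) (ι y) → Comp G′ U′ x y
  Comp-ι⁻ r with Reach-ι⁻ r
  ... | _ , eq , r′ = subst (Reach G′ U′ _) (ι-injective eq) r′

  Cycle-ι⁻ : {C : VSet (suc m)} {C′ : VSet m} → C ⊆ U → (∀ {z} → C (ι z) → C′ z)
    → Cycle G U C → Cycle G′ U′ C′
  Cycle-ι⁻ C⊆U Cι⊆C′ record
    { start = s ; rest = r ; long = long ; distinct = distinct ; inside = Cs ; closed = closed }
    with preimages (All.map C⊆U Cs)
  ... | s′ ∷ r′ , refl = record
    { start = s′
    ; rest = r′
    ; long = subst (2 ≤_) (length-map ι r′) long
    ; distinct = Unique.map⁻ distinct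
    ; inside = All.map Cι⊆C′ (All-map⁻ Cs)
    ; closed = PathAdj-map⁻ ι Adj-ι⁻ (s′ ∷ r′ ∷ʳ s′)
                 (subst (PathAdj G U) (sym (map-++ ι (s′ ∷ r′) [ s′ ])) closed)
    }

  CliqueTreeOn-ι⁺ : CliqueTreeOn G′ U′ → CliqueTreeOn G U
  CliqueTreeOn-ι⁺ ((loopless , ≤1) , comps) = (loopless⁺ , ≤1⁺) , components
    where
    loopless⁺ : ∀ x → U x → mult G x x ≡ 0
    loopless⁺ x Ux with preimage Ux
    ... | x′ , refl = loopless x′ (from Ux)

    ≤1⁺ : ∀ x y → U x → U y → mult G x y ≤ 1
    ≤1⁺ x y Ux Uy with preimage Ux | preimage Uy
    ... | x′ , refl | y′ , refl = ≤1 x′ y′ (from Ux) (from Uy)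

    components : ∀ x → U x → IsClique G U (Comp G U x) ⊎ IsTree G U (Comp G U x)
    components x Ux with preimage Ux
    ... | x′ , refl with comps x′ (from Ux)
    ...   | inj₂ tree = inj₂ (tree ∘ Cycle-ι⁻ (Reach-end G) Comp-ι⁻)
    ...   | inj₁ clique = inj₁ clique⁺
      where
      clique⁺ : IsClique G U (Comp G U (ι x′))
      clique⁺ a b x→a x→b a≢b with Reach-ι⁻ x→a | Reach-ι⁻ x→b
      ... | a′ , refl , x→a′ | b′ , refl , x→b′ = Adj-ι⁺ (clique a′ b′ x→a′ x→b′ (a≢b ∘ cong ι))

  CliqueTreeOn-ι⁻ : CliqueTreeOn G U → CliqueTreeOn G′ U′
  CliqueTreeOn-ι⁻ ((loopless , ≤1) , comps) =
    ((λ x Ux → loopless (ι x) (to Ux)) , λ x y Ux Uy → ≤1 (ι x) (ι y) (to Ux) (to Uy)) , components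
    where
    components : ∀ x → U′ x → IsClique G′ U′ (Comp G′ U′ x) ⊎ IsTree G′ U′ (Comp G′ U′ x)
    components x Ux with comps (ι x) (to Ux)
    ... | inj₁ clique = inj₁ λ a b x→a x→b a≢b →
          Adj-ι⁻ (clique (ι a) (ι b) (Reach-ι⁺ x→a) (Reach-ι⁺ x→b) (a≢b ∘ ι-injective))
    ... | inj₂ tree = inj₂ (tree ∘ Cycle-map ι ι-injective Adj-ι⁺ Reach-ι⁺)

∈-lookup : ∀ {X : Subset m} {Y : Subset n} {x y} → lookup X x ≡ lookup Y y → x ∈ X ⇔ y ∈ Y
∈-lookup eq = mk⇔ (λ x∈X → lookup⇒[]= _ _ (trans (sym eq) ([]=⇒lookup x∈X)))
                  (λ y∈Y → lookup⇒[]= _ _ (trans eq ([]=⇒lookup y∈Y)))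

∈-removeAt : ∀ (X : Subset (suc n)) v {z} → z ∈ removeAt X v ⇔ punchIn v z ∈ X
∈-removeAt X v {z} = ∈-lookup (begin
  lookup (removeAt X v) z                ≡⟨ cong (lookup (removeAt X v)) (sym (punchOut-punchIn v)) ⟩
  lookup (removeAt X v) (punchOut v≢ιz)  ≡⟨ removeAt-punchOut X v≢ιz ⟩
  lookup X (punchIn v z)                 ∎)
  where
  open ≡-Reasoning
  v≢ιz = punchInᵢ≢i v z ∘ sym

∈-insertAt : ∀ (X : Subset n) v b {z} → z ∈ X ⇔ punchIn v z ∈ insertAt X v b
∈-insertAt X v b {z} = ∈-lookup (sym (insertAt-punchIn X v b z))

∣removeAt∣≤ : ∀ (X : Subset (suc n)) v → ∣ removeAt X v ∣ ≤ ∣ X ∣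
∣removeAt∣≤ (x ∷ X) zero = ∣p∣≤∣x∷p∣ x X
∣removeAt∣≤ (inside ∷ y ∷ X) (suc v) = s≤s (∣removeAt∣≤ (y ∷ X) v)
∣removeAt∣≤ (outside ∷ y ∷ X) (suc v) = ∣removeAt∣≤ (y ∷ X) v

∣insertAt-outside∣ : ∀ (X : Subset n) v → ∣ insertAt X v outside ∣ ≡ ∣ X ∣
∣insertAt-outside∣ X zero = refl
∣insertAt-outside∣ (inside ∷ X) (suc v) = cong suc (∣insertAt-outside∣ X v)
∣insertAt-outside∣ (outside ∷ X) (suc v) = ∣insertAt-outside∣ X v

∉-∖ : ∀ {X : Subset (suc n)} {X′ : Subset n} {v} → (∀ {z} → z ∈ X′ ⇔ punchIn v z ∈ X)
  → ∀ {z} → z ∉ X′ ⇔ ((_∉ X) ∖ v) (punchIn v z)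
∉-∖ {v = v} ∈⇔∈ {z} =
  mk⇔ (λ z∉X′ → z∉X′ ∘ Equivalence.from ∈⇔∈ , punchInᵢ≢i v z ∘ sym)
      (λ (ιz∉X , _) → ιz∉X ∘ Equivalence.to ∈⇔∈)

module LeafExtension {n : ℕ} (G : Multigraph n) {v u : Fin n} (leaf : ∀ {y} → Edge G v y → y ≡ u)
  {U : VSet n} where

  contract : Fin n → Fin n
  contract z with v ≟ z
  ... | yes _ = u
  ... | no _ = z

  contract-v : contract v ≡ u
  contract-v with v ≟ v
  ... | yes _ = refl
  ... | no v≢v = contradiction refl v≢v

  contract-≢ : v ≢ z → contract z ≡ z
  contract-≢ {z} v≢z with v ≟ z
  ... | yes v≡z = contradiction v≡z v≢z
  ... | no _ = refl

  contract-u-or-id : ∀ z → contract z ≡ u ⊎ contract z ≡ z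
  contract-u-or-id z with v ≟ z
  ... | yes _ = inj₁ refl
  ... | no _ = inj₂ refl

  Adj-contract : Adj G U y z
    → contract y ≡ contract z × (U ∖ v) (contract z) ⊎ Adj G (U ∖ v) (contract y) (contract z)
  Adj-contract {y} {z} (Uy , Uz , yz) with v ≟ y | v ≟ z
  ... | yes refl | yes refl = contradiction refl (proj₁ yz)
  ... | yes refl | no v≢z with leaf yz
  ...   | refl = inj₁ (refl , Uz , v≢z)
  Adj-contract (Uy , Uz , yz) | no v≢y | yes refl with leaf (Edge-sym G yz)
  ...   | refl = inj₁ (refl , Uy , v≢y)
  Adj-contract (Uy , Uz , yz) | no v≢y | no v≢z = inj₂ ((Uy , v≢y) , (Uz , v≢z) , yz)

  Reach-contract : Reach G U x z → x ≡ z ⊎ Reach G (U ∖ v) (contract x) (contract z)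
  Reach-contract (here _) = inj₁ refl
  Reach-contract (step r yz) with Reach-contract r | Adj-contract yz
  ... | inj₁ refl | inj₁ (eq , Ucz) = inj₂ (subst (λ t → Reach G (U ∖ v) t _) (sym eq) (here Ucz))
  ... | inj₁ refl | inj₂ yz′ = inj₂ (step (here (proj₁ yz′)) yz′)
  ... | inj₂ r′ | inj₁ (eq , _) = inj₂ (subst (Reach G (U ∖ v) _) eq r′)
  ... | inj₂ r′ | inj₂ yz′ = inj₂ (step r′ yz′)

  Comp-contract : v ≢ z → Comp G U x z → Comp G (U ∖ v) (contract x) z
  Comp-contract v≢z r with Reach-contract r
  ... | inj₁ refl =
    subst (λ t → Reach G (U ∖ v) t _) (sym (contract-≢ v≢z)) (here (Reach-end G r , v≢z))
  ... | inj₂ r′ = subst (Reach G (U ∖ v) _) (contract-≢ v≢z) r′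

  Cycle-contract : contract x ≡ y → Cycle G U (Comp G U x) → Cycle G (U ∖ v) (Comp G (U ∖ v) y)
  Cycle-contract refl c = Cycle-restrict G c avoids-v
    (All.zipWith (λ (x→z , v≢z) → Comp-contract v≢z x→z) (Cycle.inside c , avoids-v))
    where
    one-neighbour : Adj G U v y → Adj G U v z → y ≡ z
    one-neighbour (_ , _ , vy) (_ , _ , vz) = trans (leaf vy) (sym (leaf vz))

    avoids-v : All (v ≢_) (vertices c)
    avoids-v = ¬Any⇒All¬ (vertices c) (leaf-∉-Cycle G one-neighbour c)

  Comp-avoiding-u : v ≢ x → ¬ Comp G (U ∖ v) x u → Comp G U x z → Comp G (U ∖ v) x z
  Comp-avoiding-u {z = z} v≢x x↛u r with Reach-contract r
  ... | inj₁ refl = here (Reach-start G r , v≢x)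
  ... | inj₂ r′ with contract-u-or-id z
  ...   | inj₁ cz≡u = contradiction (subst₂ (Reach G (U ∖ v)) (contract-≢ v≢x) cz≡u r′) x↛u
  ...   | inj₂ cz≡z = subst₂ (Reach G (U ∖ v)) (contract-≢ v≢x) cz≡z r′

  CliqueTreeOn-addLeaf : ¬ OnTriangle G u → SimpleAt G v → Decidable U
    → CliqueTreeOn G (U ∖ v) → CliqueTreeOn G U
  CliqueTreeOn-addLeaf u-free (v-loopless , v-≤1) U? ((loopless , ≤1) , comps) =
    (loopless⁺ , ≤1⁺) , components
    where
    loopless⁺ : ∀ x → U x → mult G x x ≡ 0
    loopless⁺ x Ux with v ≟ x
    ... | yes refl = v-loopless
    ... | no v≢x = loopless x (Ux , v≢x)

    ≤1⁺ : ∀ x y → U x → U y → mult G x y ≤ 1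
    ≤1⁺ x y Ux Uy with v ≟ x | v ≟ y
    ... | yes refl | _ = v-≤1 y
    ... | no _ | yes refl = subst (_≤ 1) (mult-sym G v x) (v-≤1 x)
    ... | no v≢x | no v≢y = ≤1 x y (Ux , v≢x) (Uy , v≢y)

    Comp-u-IsTree : IsTree G (U ∖ v) (Comp G (U ∖ v) u)
    Comp-u-IsTree c with Reach-start G (All.head (Cycle.inside c))
    ... | Uu with comps u Uu
    ...   | inj₁ clique = IsClique⇒IsTree G clique (here Uu) u-free c
    ...   | inj₂ tree = tree c

    components : ∀ x → U x → IsClique G U (Comp G U x) ⊎ IsTree G U (Comp G U x)
    components x Ux with v ≟ x
    ... | yes refl = inj₂ (Comp-u-IsTree ∘ Cycle-contract contract-v)
    ... | no v≢x with comps x (Ux , v≢x)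
    ...   | inj₂ tree = inj₂ (tree ∘ Cycle-contract (contract-≢ v≢x))
    ...   | inj₁ clique with Comp-clique? G (λ z → U? z ×-dec ¬? (v ≟ z)) clique (Ux , v≢x) u
    ...     | yes x→u = inj₂ (IsClique⇒IsTree G clique x→u u-free ∘ Cycle-contract (contract-≢ v≢x))
    ...     | no x↛u = inj₁ λ a b x→a x→b a≢b → Adj-mono G proj₁
                (clique a b (Comp-avoiding-u v≢x x↛u x→a) (Comp-avoiding-u v≢x x↛u x→b) a≢b)

YesInstance-delete : ∀ {G : Multigraph (suc n)} {k} v → YesInstance G k → YesInstance (G -v v) k
YesInstance-delete {G = G} v (X , ∣X∣≤k , ctds) =
  removeAt X v , ≤-trans (∣removeAt∣≤ X v) ∣X∣≤k ,
  CliqueTreeOn-ι⁻ (∉-∖ (∈-removeAt X v)) (λ (_ , v≢v) → v≢v refl) (CliqueTreeOn-mono G proj₁ ctds)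
  where open VertexDeletion G v {U = (_∉ X) ∖ v}

YesInstance-addLeaf : ∀ {G : Multigraph (suc n)} {k v u}
  → (∀ {y} → Edge G v y → y ≡ u) → ¬ OnTriangle G u → SimpleAt G v
  → YesInstance (G -v v) k → YesInstance G k
YesInstance-addLeaf {G = G} {v = v} leaf u-free v-simple (X′ , ∣X′∣≤k , ctds′) =
  X , subst (_≤ _) (sym (∣insertAt-outside∣ X′ v)) ∣X′∣≤k ,
  CliqueTreeOn-addLeaf u-free v-simple (λ z → ¬? (z ∈? X))
    (CliqueTreeOn-ι⁺ (∉-∖ (∈-insertAt X′ v outside)) (λ (_ , v≢v) → v≢v refl) ctds′)
  where
  X = insertAt X′ v outside
  open VertexDeletion G v {U = (_∉ X) ∖ v}
  open LeafExtension G leaf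

V₁-step : ∀ {G : Multigraph n} {S} → V₁ G S x → Adj G (Rest G S) x y → V₁ G S y
V₁-step (z , z∉S , z→x , clique , three) xy = z , z∉S , step z→x xy , clique , three

module _ {G : Multigraph n} {S : Subset n} {v u : Fin n} (v-u : Adj G (V₂ G S) v u)
  (no-S : ∀ s → s ∈ S → mult G v s ≡ 0 × mult G u s ≡ 0) where

  private
    v∉S = proj₁ (proj₁ v-u)
    u∉S = proj₁ (proj₁ (proj₂ v-u))

    neighbour-∉S : (∀ s → s ∈ S → mult G x s ≡ 0) → Edge G x y → y ∉ S
    neighbour-∉S no-S-x (_ , 1≤xy) y∈S = contradiction (subst (1 ≤_) (no-S-x _ y∈S) 1≤xy) λ ()

  v-leaf : (∀ y → Adj G (V₂ G S) v y → y ≡ u) → ∀ {y} → Edge G v y → y ≡ u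
  v-leaf leaf {y} vy = leaf y (proj₁ v-u , (y∉S , y∉V₁) , vy)
    where
    y∉S = neighbour-∉S (λ s → proj₁ ∘ no-S s) vy
    y∉V₁ = λ V₁y → proj₂ (proj₁ v-u) (V₁-step V₁y (y∉S , v∉S , Edge-sym G vy))

  u-triangle-free : IsCTDS G S → ¬ OnTriangle G u
  u-triangle-free (_ , comps) (a , b , ua , ub , ab) =
    proj₂ (proj₁ v-u)
      (v , v∉S , here v∉S , clique , u , a , b , v→u , v→a , v→b , proj₁ ua , proj₁ ub , proj₁ ab)
    where
    a∉S = neighbour-∉S (λ s → proj₂ ∘ no-S s) ua
    b∉S = neighbour-∉S (λ s → proj₂ ∘ no-S s) ub
    v→u = step (here v∉S) (v∉S , u∉S , proj₂ (proj₂ v-u))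
    v→a = step v→u (u∉S , a∉S , ua)
    v→b = step v→u (u∉S , b∉S , ub)
    clique = Triangle⇒IsClique G (comps v v∉S) v→u v→a v→b
               (u∉S , a∉S , ua) (a∉S , b∉S , ab) (b∉S , u∉S , Edge-sym G ub)

  v-simple : IsCTDS G S → SimpleAt G v
  v-simple ((loopless , ≤1) , _) = loopless v v∉S , v-≤1
    where
    v-≤1 : ∀ y → mult G v y ≤ 1
    v-≤1 y with y ∈? S
    ... | yes y∈S = subst (_≤ 1) (sym (proj₁ (no-S y y∈S))) z≤n
    ... | no y∉S = ≤1 v y v∉S y∉S

lemma24 : ∀ {m} (G : Multigraph (suc m)) (k : ℕ) (S : Subset (suc m))
    → ∣ S ∣ ≤ 4 * k
    → IsCTDS G S
    → (w v u : Fin (suc m))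
    → V₂ G S w
    → Comp G (V₂ G S) w v
    → Adj G (V₂ G S) v u
    → (∀ y → Adj G (V₂ G S) v y → y ≡ u)
    → (∀ s → s ∈ S → (mult G v s ≡ 0) × (mult G u s ≡ 0))
    → YesInstance G k ⇔ YesInstance (G -v v) k
lemma24 G k S _ ctds _ v u _ _ v-u leaf no-S =
  mk⇔ (YesInstance-delete v)
      (YesInstance-addLeaf (v-leaf v-u no-S leaf) (u-triangle-free v-u no-S ctds) (v-simple v-u no-S ctds))
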